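{- Let $n\ge2$ be an integer and let $x_1,\dots,x_n$ be positive integers such that $$b=\Big(\sum_{i=1}^n x_i\Big)^2\Big/\prod_{i=1}^n x_i$$ is an integer. Then $b\le n^2$. -}

module Defs where

open import Data.Nat using (ℕ; _+_; _*_)
open import Data.Fin using (Fin)
open import Data.Vec.Functional using (Vector; foldr)

sumF : ∀ {n} → (Fin n → ℕ) → ℕ
sumF = foldr _+_ 0

prodF : ∀ {n} → (Fin n → ℕ) → ℕ
prodF = foldr _*_ 1

{-# OPTIONS --safe #-}
-- Vieta jumping. Let a be a largest xᵢ and S, P the sum and product of the others.
-- Then a is a root of t² − (bP − 2S) t + S², whose other root d = S²/a is again a
-- positive integer; replacing a by d keeps b and lowers the sum when d < a, so we may
-- assume a ≤ d. If c is the largest of the other xᵢ, then c ≤ a ≤ d gives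
-- c (a + d) ≤ a d + c², hence b c² ≤ c b P = c (a + d) + 2 c S ≤ (c + S)² ≤ (n c)².
module Submission where

open import Defs
open import Data.Nat
  using (ℕ; zero; suc; _+_; _∸_; _*_; _^_; _≤_; _<_; z≤n; s≤s; z<s; _<?_; >-nonZero)
open import Data.Nat.Properties
open import Data.Nat.Induction using (<-wellFounded)
open import Data.Nat.Tactic.RingSolver using (solve)
open import Data.Fin using (Fin; zero; suc; punchIn)
open import Data.List using ([]; _∷_)
open import Data.Vec.Functional using (foldr; removeAt; tail) renaming (_∷_ to _◂_)
open import Data.Product using (Σ-syntax; ∃-syntax; _×_; _,_)
open import Data.Sum using (inj₁; inj₂)
open import Function using (_∘_)
open import Induction.WellFounded using (Acc; acc)
open import Relation.Nullary using (yes; no)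
open import Relation.Binary.PropositionalEquality
import Algebra.Properties.CommutativeSemigroup as CommutativeSemigroupProperties

module +-Properties = CommutativeSemigroupProperties +-commutativeSemigroup
module *-Properties = CommutativeSemigroupProperties *-commutativeSemigroup

module _ {A : Set} (_∙_ : A → A → A) (ε : A)
         (x∙yz≡y∙xz : ∀ x y z → x ∙ (y ∙ z) ≡ y ∙ (x ∙ z)) where

  foldr-removeAt : ∀ {n} (x : Fin (suc n) → A) k →
                   foldr _∙_ ε x ≡ x k ∙ foldr _∙_ ε (removeAt x k)
  foldr-removeAt x zero = refl
  foldr-removeAt {suc n} x (suc k) =
    trans (cong (x zero ∙_) (foldr-removeAt (tail x) k)) (x∙yz≡y∙xz _ _ _)

sumF-removeAt : ∀ {n} (x : Fin (suc n) → ℕ) k → sumF x ≡ x k + sumF (removeAt x k)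
sumF-removeAt = foldr-removeAt _+_ 0 +-Properties.x∙yz≈y∙xz

prodF-removeAt : ∀ {n} (x : Fin (suc n) → ℕ) k → prodF x ≡ x k * prodF (removeAt x k)
prodF-removeAt = foldr-removeAt _*_ 1 *-Properties.x∙yz≈y∙xz

argmax : ∀ {n} (x : Fin (suc n) → ℕ) → Σ[ k ∈ Fin (suc n) ] (∀ i → x i ≤ x k)
argmax {zero} x = zero , λ { zero → ≤-refl }
argmax {suc n} x with argmax (tail x)
... | k , x≤xk with ≤-total (x zero) (x (suc k))
...   | inj₁ x₀≤xk = suc k , λ { zero → x₀≤xk ; (suc i) → x≤xk i }
...   | inj₂ xk≤x₀ =
      zero , λ { zero → ≤-refl ; (suc i) → ≤-trans (x≤xk i) xk≤x₀ }

≤-sumF : ∀ {n} (x : Fin n → ℕ) i → x i ≤ sumF x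
≤-sumF x zero = m≤m+n _ _
≤-sumF x (suc i) = ≤-trans (≤-sumF (tail x) i) (m≤n+m _ _)

sumF-≤ : ∀ {n c} {x : Fin n → ℕ} → (∀ i → x i ≤ c) → sumF x ≤ n * c
sumF-≤ {zero} x≤c = z≤n
sumF-≤ {suc n} x≤c = +-mono-≤ (x≤c zero) (sumF-≤ (x≤c ∘ suc))

prodF-pos : ∀ {n} {x : Fin n → ℕ} → (∀ i → 0 < x i) → 0 < prodF x
prodF-pos {zero} x>0 = z<s
prodF-pos {suc n} x>0 = *-mono-≤ (x>0 zero) (prodF-pos (x>0 ∘ suc))

≤-prodF : ∀ {n} {x : Fin n → ℕ} → (∀ i → 0 < x i) → ∀ i → x i ≤ prodF x
≤-prodF {x = x} x>0 zero = m≤m*n (x zero) _ {{>-nonZero (prodF-pos (x>0 ∘ suc))}}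
≤-prodF {x = x} x>0 (suc i) =
  ≤-trans (≤-prodF (x>0 ∘ suc) i) (m≤n*m _ (x zero) {{>-nonZero (x>0 zero)}})

m^2≡m*m : ∀ m → m ^ 2 ≡ m * m
m^2≡m*m m = cong (m *_) (*-identityʳ m)

-- (a − c) (d − c) ≥ 0, stated without truncated subtraction.
c*[a+d]≤a*d+c*c : ∀ {a c d} → c ≤ a → c ≤ d → c * (a + d) ≤ a * d + c * c
c*[a+d]≤a*d+c*c {c = c} c≤a c≤d with m≤n⇒∃[o]m+o≡n c≤a | m≤n⇒∃[o]m+o≡n c≤d
... | u , refl | v , refl = begin
  c * ((c + u) + (c + v))                  ≤⟨ m≤m+n _ (u * v) ⟩
  c * ((c + u) + (c + v)) + u * v          ≡⟨ solve (c ∷ u ∷ v ∷ []) ⟩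
  (c + u) * (c + v) + c * c                ∎
  where open ≤-Reasoning

m*n≡o*o⇒n>0 : ∀ m {n o} → 0 < o → m * n ≡ o * o → 0 < n
m*n≡o*o⇒n>0 m {suc n} _ _ = z<s
m*n≡o*o⇒n>0 m {zero} {suc o} _ m*0≡o*o with trans (sym (*-zeroʳ m)) m*0≡o*o
... | ()

module Vieta (b P S : ℕ) where

  otherRoot : ∀ {a} → 0 < a → b * (a * P) ≡ (a + S) ^ 2 →
              ∃[ d ] (b * P ≡ a + 2 * S + d × a * d ≡ S * S)
  otherRoot {a} a>0 eq = d , sym a+2S+d≡bP , a*d≡S*S
    where
    instance _ = >-nonZero a>0
    a*bP≡a*[a+2S]+S*S : a * (b * P) ≡ a * (a + 2 * S) + S * S
    a*bP≡a*[a+2S]+S*S = begin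
      a * (b * P)              ≡⟨ *-Properties.x∙yz≈y∙xz a b P ⟩
      b * (a * P)              ≡⟨ eq ⟩
      (a + S) ^ 2              ≡⟨ m^2≡m*m (a + S) ⟩
      (a + S) * (a + S)        ≡⟨ solve (a ∷ S ∷ []) ⟩
      a * (a + 2 * S) + S * S  ∎
      where open ≡-Reasoning
    a+2S≤bP : a + 2 * S ≤ b * P
    a+2S≤bP =
      *-cancelˡ-≤ a (≤-trans (m≤m+n _ _) (≤-reflexive (sym a*bP≡a*[a+2S]+S*S)))
    d = b * P ∸ (a + 2 * S)
    a+2S+d≡bP : a + 2 * S + d ≡ b * P
    a+2S+d≡bP = m+[n∸m]≡n a+2S≤bP
    a*d≡S*S : a * d ≡ S * S
    a*d≡S*S = +-cancelˡ-≡ (a * (a + 2 * S)) _ _ (begin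
      a * (a + 2 * S) + a * d  ≡⟨ *-distribˡ-+ a (a + 2 * S) d ⟨
      a * (a + 2 * S + d)      ≡⟨ cong (a *_) a+2S+d≡bP ⟩
      a * (b * P)              ≡⟨ a*bP≡a*[a+2S]+S*S ⟩
      a * (a + 2 * S) + S * S  ∎)
      where open ≡-Reasoning

  jump : ∀ a {d} → b * P ≡ a + 2 * S + d → a * d ≡ S * S → b * (d * P) ≡ (d + S) ^ 2
  jump a {d} bP≡a+2S+d a*d≡S*S = begin
    b * (d * P)                ≡⟨ *-Properties.x∙yz≈y∙xz b d P ⟩
    d * (b * P)                ≡⟨ cong (d *_) bP≡a+2S+d ⟩
    d * (a + 2 * S + d)        ≡⟨ solve (a ∷ d ∷ S ∷ []) ⟩
    a * d + 2 * S * d + d * d  ≡⟨ cong (λ t → t + 2 * S * d + d * d) a*d≡S*S ⟩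
    S * S + 2 * S * d + d * d  ≡⟨ solve (d ∷ S ∷ []) ⟩
    (d + S) * (d + S)          ≡⟨ m^2≡m*m (d + S) ⟨
    (d + S) ^ 2                ∎
    where open ≡-Reasoning

  bound : ∀ n {a c d} → 0 < c → c ≤ a → c ≤ d → c ≤ P → c + S ≤ n * c →
          b * P ≡ a + 2 * S + d → a * d ≡ S * S → b ≤ n ^ 2
  bound n {a} {c} {d} c>0 c≤a c≤d c≤P c+S≤nc bP≡a+2S+d a*d≡S*S =
    ≤-trans (*-cancelʳ-≤ b (n * n) (c * c) {{m*n≢0 c c}} b*c²≤n²*c²)
            (≤-reflexive (sym (m^2≡m*m n)))
    where
    instance _ = >-nonZero c>0
    b*c²≤n²*c² : b * (c * c) ≤ n * n * (c * c)
    b*c²≤n²*c² = begin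
      b * (c * c)                ≡⟨ solve (b ∷ c ∷ []) ⟩
      c * (b * c)                ≤⟨ *-monoʳ-≤ c (*-monoʳ-≤ b c≤P) ⟩
      c * (b * P)                ≡⟨ cong (c *_) bP≡a+2S+d ⟩
      c * (a + 2 * S + d)        ≡⟨ solve (a ∷ c ∷ d ∷ S ∷ []) ⟩
      c * (a + d) + 2 * c * S    ≤⟨ +-monoˡ-≤ (2 * c * S) (c*[a+d]≤a*d+c*c c≤a c≤d) ⟩
      a * d + c * c + 2 * c * S  ≡⟨ cong (λ t → t + c * c + 2 * c * S) a*d≡S*S ⟩
      S * S + c * c + 2 * c * S  ≡⟨ solve (c ∷ S ∷ []) ⟩
      (c + S) * (c + S)          ≤⟨ *-mono-≤ c+S≤nc c+S≤nc ⟩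
      (n * c) * (n * c)          ≡⟨ solve (n ∷ c ∷ []) ⟩
      n * n * (c * c)            ∎
      where open ≤-Reasoning

descent : ∀ {b m} (x : Fin (2 + m) → ℕ) → (∀ i → 0 < x i) →
          b * prodF x ≡ sumF x ^ 2 → Acc _<_ (sumF x) → b ≤ (2 + m) ^ 2
descent {b} {m} x x>0 b*Πx≡[Σx]² (acc smaller) with argmax x
... | k , x≤a = jump-or-stop (otherRoot (x>0 k) b*aP≡[a+S]²)
  where
  a = x k
  r = removeAt x k
  S = sumF r
  P = prodF r
  open Vieta b P S
  r>0 : ∀ i → 0 < r i
  r>0 = x>0 ∘ punchIn k
  b*aP≡[a+S]² : b * (a * P) ≡ (a + S) ^ 2
  b*aP≡[a+S]² =
    subst₂ (λ Π Σ → b * Π ≡ Σ ^ 2) (prodF-removeAt x k) (sumF-removeAt x k) b*Πx≡[Σx]²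
  jump-or-stop : ∃[ d ] (b * P ≡ a + 2 * S + d × a * d ≡ S * S) → b ≤ (2 + m) ^ 2
  jump-or-stop (d , bP≡a+2S+d , a*d≡S*S) with d <? a | argmax r
  ... | yes d<a | _ =
    descent (d ◂ r) (λ { zero → d>0 ; (suc i) → r>0 i }) (jump a bP≡a+2S+d a*d≡S*S)
      (smaller (≤-trans (+-monoˡ-< S d<a) (≤-reflexive (sym (sumF-removeAt x k)))))
    where
    d>0 : 0 < d
    d>0 = m*n≡o*o⇒n>0 a (≤-trans (r>0 zero) (≤-sumF r zero)) a*d≡S*S
  ... | no d≮a | j , r≤c =
    bound (2 + m) (r>0 j) c≤a (≤-trans c≤a (≮⇒≥ d≮a)) (≤-prodF r>0 j)
      (+-monoʳ-≤ (r j) (sumF-≤ r≤c)) bP≡a+2S+d a*d≡S*S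
    where
    c≤a : r j ≤ a
    c≤a = x≤a (punchIn k j)

theoremA1 : (n : ℕ) → 2 ≤ n → (x : Fin n → ℕ) → (∀ i → 0 < x i) →
            (b : ℕ) → b * prodF x ≡ sumF x ^ 2 → b ≤ n ^ 2
theoremA1 (suc (suc m)) (s≤s (s≤s z≤n)) x x>0 b b*Πx≡[Σx]² =
  descent x x>0 b*Πx≡[Σx]² (<-wellFounded (sumF x))
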